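{- Let $\mathcal{S}=(a_{n,m})_{n,m\geq 0}$ be the infinite matrix of complex numbers determined by an initial row $(a_{0,m})_{m\geq0}$ via $a_{n+1,m}=a_{n,m+1}+m\,a_{n,m}$ for all $n,m\geq 0$. Fix $r\geq 0$ and let $A_r(z)=\sum_{k\geq 0}a_{0,k+r}\frac{z^k}{k!}$ and $B_r(z)=\sum_{n\geq 0}a_{n,r}\frac{z^n}{n!}$ (formal power series). Then $$B_r(z)=e^{rz}A_r\left(e^{z}-1\right).$$ -}

module Defs where

open import Level using (Level)
open import Data.Nat using (ℕ; zero; suc; _∸_)
open import Algebra.Bundles using (CommutativeRing)

module PowerSeries {c ℓ : Level} (R : CommutativeRing c ℓ) where
  open CommutativeRing R

  nat : ℕ → Carrier
  nat zero    = 0#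
  nat (suc n) = 1# + nat n

  pow : Carrier → ℕ → Carrier
  pow x zero    = 1#
  pow x (suc n) = x * pow x n

  Σ< : ℕ → (ℕ → Carrier) → Carrier
  Σ< zero    f = 0#
  Σ< (suc n) f = Σ< n f + f n

  Series : Set c
  Series = ℕ → Carrier

  _≋_ : Series → Series → Set ℓ
  F ≋ G = ∀ n → F n ≈ G n

  oneS : Series
  oneS zero    = 1#
  oneS (suc n) = 0#

  _⊛_ : Series → Series → Series
  (F ⊛ G) n = Σ< (suc n) (λ i → F i * G (n ∸ i))

  powS : Series → ℕ → Series
  powS G zero    = oneS
  powS G (suc k) = G ⊛ powS G k

  -- composition A(G(z)) for G with zero constant term:
  -- [z^n] A(G) = Σ_{k ≤ n} A_k [z^n] G^k  (G^k has order ≥ k)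
  _∘S_ : Series → Series → Series
  (A ∘S G) n = Σ< (suc n) (λ k → A k * powS G k n)

  -- Series needing 1/n!, given a chosen inverse  inv n  of n! in R
  module WithFactorialInverses (inv : ℕ → Carrier) where

    expS : Carrier → Series
    expS x n = pow x n * inv n

    expm1S : Series
    expm1S zero    = 0#
    expm1S (suc n) = inv (suc n)

-- Let B_r be the exponential generating function of column r and F_r = e^{rz} A_r(e^z − 1).
-- The matrix recurrence says exactly that B_r′ = B_{r+1} + r B_r. The F_r satisfy the same
-- system: since A_r′ = A_{r+1} and (e^z − 1)′ = e^z, the product and chain rules give
-- F_r′ = r F_r + e^{rz} e^z A_{r+1}(e^z − 1), and e^z e^{rz} = e^{(r+1)z}. Both families have
-- constant term a_{0,r}, and because n + 1 is invertible a solution of the system is determined,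
-- coefficient by coefficient, by its constant terms.

module Submission where

open import Level using (Level)
open import Data.Nat using (ℕ; zero; suc; _!; _∸_; _≤_; _<_; z≤n; s≤s)
  renaming (_+_ to _+ℕ_; _*_ to _*ℕ_)
import Data.Nat.Properties as ℕ
open import Data.Sum using (inj₁; inj₂)
open import Data.Unit using (⊤; tt)
import Relation.Binary.PropositionalEquality as ≡
open import Algebra.Bundles using (CommutativeRing)
open import Defs

module _ {c ℓ : Level} (R : CommutativeRing c ℓ) where
  open CommutativeRing R
  open PowerSeries R
  open import Relation.Binary.Reasoning.Setoid setoid
  open import Algebra.Properties.CommutativeSemigroup +-commutativeSemigroup
    using (interchange)
  open import Algebra.Properties.CommutativeSemigroup *-commutativeSemigroup
    using (x∙yz≈y∙xz; xy∙z≈zx∙y) renaming (interchange to *-interchange)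
  open import Algebra.Properties.Semiring.Mult semiring
    using (_×_; ×-homo-+; ×1-homo-*)

  nat≈×1# : ∀ n → nat n ≈ n × 1#
  nat≈×1# zero    = refl
  nat≈×1# (suc n) = +-cong refl (nat≈×1# n)

  nat-homo-+ : ∀ m n → nat (m +ℕ n) ≈ nat m + nat n
  nat-homo-+ m n = begin
    nat (m +ℕ n)        ≈⟨ nat≈×1# (m +ℕ n) ⟩
    (m +ℕ n) × 1#       ≈⟨ ×-homo-+ 1# m n ⟩
    m × 1# + n × 1#     ≈⟨ +-cong (nat≈×1# m) (nat≈×1# n) ⟨
    nat m + nat n       ∎

  nat-homo-* : ∀ m n → nat (m *ℕ n) ≈ nat m * nat n
  nat-homo-* m n = begin
    nat (m *ℕ n)      ≈⟨ nat≈×1# (m *ℕ n) ⟩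
    (m *ℕ n) × 1#     ≈⟨ ×1-homo-* m n ⟩
    (m × 1#) * (n × 1#)       ≈⟨ *-cong (nat≈×1# m) (nat≈×1# n) ⟨
    nat m * nat n             ∎

  nat-suc-* : ∀ n x → nat (suc n) * x ≈ x + nat n * x
  nat-suc-* n x = trans (distribʳ x 1# (nat n)) (+-cong (*-identityˡ x) refl)

  *-cancelˡ-invertible : ∀ {k u x y} → k * u ≈ 1# → u * x ≈ u * y → x ≈ y
  *-cancelˡ-invertible {k} {u} {x} {y} ku≈1 ux≈uy = begin
    x             ≈⟨ *-identityˡ x ⟨
    1# * x        ≈⟨ *-cong ku≈1 refl ⟨
    k * u * x     ≈⟨ *-assoc k u x ⟩
    k * (u * x)   ≈⟨ *-cong refl ux≈uy ⟩
    k * (u * y)   ≈⟨ *-assoc k u y ⟨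
    k * u * y     ≈⟨ *-cong ku≈1 refl ⟩
    1# * y        ≈⟨ *-identityˡ y ⟩
    y             ∎

  pow-1# : ∀ n → pow 1# n ≈ 1#
  pow-1# zero    = refl
  pow-1# (suc n) = trans (*-identityˡ _) (pow-1# n)

  Σ<-cong : ∀ n {f g : ℕ → Carrier} → (∀ i → f i ≈ g i) → Σ< n f ≈ Σ< n g
  Σ<-cong zero    f≈g = refl
  Σ<-cong (suc n) f≈g = +-cong (Σ<-cong n f≈g) (f≈g n)

  Σ<-cong-< : ∀ n {f g : ℕ → Carrier} → (∀ {i} → i < n → f i ≈ g i) → Σ< n f ≈ Σ< n g
  Σ<-cong-< zero    f≈g = refl
  Σ<-cong-< (suc n) f≈g =
    +-cong (Σ<-cong-< n (λ i<n → f≈g (ℕ.m<n⇒m<1+n i<n))) (f≈g ℕ.≤-refl)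

  Σ<-zero : ∀ n {f : ℕ → Carrier} → (∀ {i} → i < n → f i ≈ 0#) → Σ< n f ≈ 0#
  Σ<-zero zero    f≈0 = refl
  Σ<-zero (suc n) f≈0 =
    trans (+-cong (Σ<-zero n (λ i<n → f≈0 (ℕ.m<n⇒m<1+n i<n))) (f≈0 ℕ.≤-refl))
          (+-identityʳ 0#)

  Σ<-extend : ∀ {m} n {f : ℕ → Carrier} → m ≤ n → (∀ {i} → m ≤ i → f i ≈ 0#) →
              Σ< n f ≈ Σ< m f
  Σ<-extend n m≤n f≈0 with ℕ.m≤n⇒m<n∨m≡n m≤n
  ... | inj₂ ≡.refl = refl
  ... | inj₁ (s≤s {n = n′} m≤n′) =
    trans (+-cong (Σ<-extend n′ m≤n′ f≈0) (f≈0 m≤n′)) (+-identityʳ _)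

  Σ<-distrib-+ : ∀ n (f g : ℕ → Carrier) → Σ< n (λ i → f i + g i) ≈ Σ< n f + Σ< n g
  Σ<-distrib-+ zero    f g = sym (+-identityʳ 0#)
  Σ<-distrib-+ (suc n) f g = trans (+-cong (Σ<-distrib-+ n f g) refl) (interchange _ _ _ _)

  *-distribˡ-Σ< : ∀ n x (f : ℕ → Carrier) → x * Σ< n f ≈ Σ< n (λ i → x * f i)
  *-distribˡ-Σ< zero    x f = zeroʳ x
  *-distribˡ-Σ< (suc n) x f = trans (distribˡ x _ _) (+-cong (*-distribˡ-Σ< n x f) refl)

  *-distribʳ-Σ< : ∀ n x (f : ℕ → Carrier) → Σ< n f * x ≈ Σ< n (λ i → f i * x)
  *-distribʳ-Σ< zero    x f = zeroˡ x
  *-distribʳ-Σ< (suc n) x f = trans (distribʳ x _ _) (+-cong (*-distribʳ-Σ< n x f) refl)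

  Σ<-head : ∀ n (f : ℕ → Carrier) → Σ< (suc n) f ≈ f 0 + Σ< n (λ i → f (suc i))
  Σ<-head zero    f = +-comm 0# (f 0)
  Σ<-head (suc n) f = trans (+-cong (Σ<-head n f) refl) (+-assoc _ _ _)

  Σ<-reverse : ∀ n (f : ℕ → Carrier) → Σ< n f ≈ Σ< n (λ i → f (n ∸ suc i))
  Σ<-reverse zero    f = refl
  Σ<-reverse (suc n) f = begin
    Σ< n f + f n                       ≈⟨ +-cong (Σ<-reverse n f) refl ⟩
    Σ< n (λ i → f (n ∸ suc i)) + f n   ≈⟨ +-comm _ _ ⟩
    f n + Σ< n (λ i → f (n ∸ suc i))   ≈⟨ Σ<-head n (λ i → f (suc n ∸ suc i)) ⟨
    Σ< (suc n) (λ i → f (suc n ∸ suc i)) ∎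

  Σ<-swap : ∀ m n (f : ℕ → ℕ → Carrier) →
            Σ< m (λ i → Σ< n (f i)) ≈ Σ< n (λ j → Σ< m (λ i → f i j))
  Σ<-swap zero    n f = sym (Σ<-zero n (λ _ → refl))
  Σ<-swap (suc m) n f = trans (+-cong (Σ<-swap m n f) refl) (sym (Σ<-distrib-+ n _ _))

  Σ<-triangle : ∀ n (f : ℕ → ℕ → Carrier) →
                Σ< n (λ i → Σ< (suc i) (f i)) ≈ Σ< n (λ j → Σ< (n ∸ j) (λ l → f (j +ℕ l) j))
  Σ<-triangle zero    f = refl
  Σ<-triangle (suc n) f = begin
    Σ< n (λ i → Σ< (suc i) (f i)) + Σ< (suc n) (f n)  ≈⟨ +-cong (Σ<-triangle n f) refl ⟩
    Σ< n column + Σ< (suc n) (f n)                    ≈⟨ +-cong last-column-empty refl ⟨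
    Σ< (suc n) column + Σ< (suc n) (f n)              ≈⟨ Σ<-distrib-+ (suc n) column (f n) ⟨
    Σ< (suc n) (λ j → column j + f n j)               ≈⟨ Σ<-cong-< (suc n) column-suc ⟩
    Σ< (suc n) (λ j → Σ< (suc n ∸ j) (λ l → f (j +ℕ l) j)) ∎
    where
    column : ℕ → Carrier
    column j = Σ< (n ∸ j) (λ l → f (j +ℕ l) j)
    last-column-empty : Σ< (suc n) column ≈ Σ< n column
    last-column-empty =
      trans (+-cong refl (reflexive (≡.cong (λ k → Σ< k (λ l → f (n +ℕ l) n)) (ℕ.n∸n≡0 n))))
            (+-identityʳ _)
    column-suc : ∀ {j} → j < suc n → column j + f n j ≈ Σ< (suc n ∸ j) (λ l → f (j +ℕ l) j)
    column-suc {j} (s≤s j≤n) = reflexive (≡.sym (≡.trans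
      (≡.cong (λ k → Σ< k (λ l → f (j +ℕ l) j)) (ℕ.+-∸-assoc 1 j≤n))
      (≡.cong (λ k → column j + f k j) (ℕ.m+[n∸m]≡n j≤n))))

  _⊕_ : Series → Series → Series
  (F ⊕ G) n = F n + G n

  _·_ : Carrier → Series → Series
  (x · F) n = x * F n

  ⊛-congˡ : ∀ {F F′} G → F ≋ F′ → (F ⊛ G) ≋ (F′ ⊛ G)
  ⊛-congˡ G F≋F′ n = Σ<-cong (suc n) (λ i → *-cong (F≋F′ i) refl)

  ⊛-congʳ : ∀ F {G G′} → G ≋ G′ → (F ⊛ G) ≋ (F ⊛ G′)
  ⊛-congʳ F G≋G′ n = Σ<-cong (suc n) (λ i → *-cong refl (G≋G′ (n ∸ i)))

  ⊛-coeff-0 : ∀ F G → (F ⊛ G) 0 ≈ F 0 * G 0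
  ⊛-coeff-0 F G = +-identityˡ _

  ⊛-identityˡ : ∀ F → (oneS ⊛ F) ≋ F
  ⊛-identityˡ F n = begin
    (oneS ⊛ F) n                                ≈⟨ Σ<-head n _ ⟩
    1# * F n + Σ< n (λ i → 0# * F (n ∸ suc i))  ≈⟨ +-cong (*-identityˡ _) (Σ<-zero n (λ _ → zeroˡ _)) ⟩
    F n + 0#                                    ≈⟨ +-identityʳ _ ⟩
    F n                                         ∎

  ⊛-comm : ∀ F G → (F ⊛ G) ≋ (G ⊛ F)
  ⊛-comm F G n = trans (Σ<-reverse (suc n) _) (Σ<-cong-< (suc n) swapped)
    where
    swapped : ∀ {i} → i < suc n → F (n ∸ i) * G (n ∸ (n ∸ i)) ≈ G i * F (n ∸ i)
    swapped (s≤s i≤n) =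
      trans (*-cong refl (reflexive (≡.cong G (ℕ.m∸[m∸n]≡n i≤n)))) (*-comm _ _)

  ⊛-assoc : ∀ F G H → ((F ⊛ G) ⊛ H) ≋ (F ⊛ (G ⊛ H))
  ⊛-assoc F G H n = begin
    Σ< (suc n) (λ i → Σ< (suc i) (λ j → F j * G (i ∸ j)) * H (n ∸ i))
      ≈⟨ Σ<-cong (suc n) (λ i → *-distribʳ-Σ< (suc i) _ _) ⟩
    Σ< (suc n) (λ i → Σ< (suc i) (λ j → F j * G (i ∸ j) * H (n ∸ i)))
      ≈⟨ Σ<-triangle (suc n) (λ i j → F j * G (i ∸ j) * H (n ∸ i)) ⟩
    Σ< (suc n) (λ j → Σ< (suc n ∸ j) (λ l → F j * G (j +ℕ l ∸ j) * H (n ∸ (j +ℕ l))))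
      ≈⟨ Σ<-cong-< (suc n) inner ⟩
    Σ< (suc n) (λ j → F j * Σ< (suc (n ∸ j)) (λ l → G l * H (n ∸ j ∸ l))) ∎
    where
    reindex : ∀ j l → F j * G (j +ℕ l ∸ j) * H (n ∸ (j +ℕ l)) ≈
                      F j * (G l * H (n ∸ j ∸ l))
    reindex j l = trans (*-assoc _ _ _) (*-cong refl (*-cong
      (reflexive (≡.cong G (ℕ.m+n∸m≡n j l)))
      (reflexive (≡.cong H (≡.sym (ℕ.∸-+-assoc n j l))))))
    inner : ∀ {j} → j < suc n →
            Σ< (suc n ∸ j) (λ l → F j * G (j +ℕ l ∸ j) * H (n ∸ (j +ℕ l))) ≈
            F j * Σ< (suc (n ∸ j)) (λ l → G l * H (n ∸ j ∸ l))
    inner {j} (s≤s j≤n) = begin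
      Σ< (suc n ∸ j) term
        ≈⟨ reflexive (≡.cong (λ k → Σ< k term) (ℕ.+-∸-assoc 1 j≤n)) ⟩
      Σ< (suc (n ∸ j)) term
        ≈⟨ Σ<-cong (suc (n ∸ j)) (reindex j) ⟩
      Σ< (suc (n ∸ j)) (λ l → F j * (G l * H (n ∸ j ∸ l)))
        ≈⟨ *-distribˡ-Σ< (suc (n ∸ j)) (F j) _ ⟨
      F j * Σ< (suc (n ∸ j)) (λ l → G l * H (n ∸ j ∸ l)) ∎
      where
      term : ℕ → Carrier
      term l = F j * G (j +ℕ l ∸ j) * H (n ∸ (j +ℕ l))

  ·-⊛ : ∀ x F G → ((x · F) ⊛ G) ≋ (x · (F ⊛ G))
  ·-⊛ x F G n =
    trans (Σ<-cong (suc n) (λ i → *-assoc x (F i) _)) (sym (*-distribˡ-Σ< (suc n) x _))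

  ⊛-· : ∀ x F G → (F ⊛ (x · G)) ≋ (x · (F ⊛ G))
  ⊛-· x F G n =
    trans (Σ<-cong (suc n) (λ i → x∙yz≈y∙xz (F i) x _)) (sym (*-distribˡ-Σ< (suc n) x _))

  ∂ : Series → Series
  ∂ F n = nat (suc n) * F (suc n)

  -- The Leibniz rule is proved for θ = z d/dz, where the weight n of z^n splits as i + (n − i).
  θ : Series → Series
  θ F n = nat n * F n

  ∂-cong : ∀ {F G} → F ≋ G → ∂ F ≋ ∂ G
  ∂-cong F≋G n = *-cong refl (F≋G (suc n))

  nat-split : ∀ {i n} → i ≤ n → ∀ x y →
              nat n * (x * y) ≈ nat i * x * y + x * (nat (n ∸ i) * y)
  nat-split {i} {n} i≤n x y = begin
    nat n * (x * y)
      ≈⟨ *-cong (reflexive (≡.cong nat (ℕ.m+[n∸m]≡n i≤n))) refl ⟨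
    nat (i +ℕ (n ∸ i)) * (x * y)
      ≈⟨ *-cong (nat-homo-+ i (n ∸ i)) refl ⟩
    (nat i + nat (n ∸ i)) * (x * y)
      ≈⟨ distribʳ _ _ _ ⟩
    nat i * (x * y) + nat (n ∸ i) * (x * y)
      ≈⟨ +-cong (sym (*-assoc _ _ _)) (x∙yz≈y∙xz _ _ _) ⟩
    nat i * x * y + x * (nat (n ∸ i) * y) ∎

  θ-Leibniz : ∀ F G → θ (F ⊛ G) ≋ ((θ F ⊛ G) ⊕ (F ⊛ θ G))
  θ-Leibniz F G n = begin
    nat n * Σ< (suc n) (λ i → F i * G (n ∸ i))
      ≈⟨ *-distribˡ-Σ< (suc n) (nat n) _ ⟩
    Σ< (suc n) (λ i → nat n * (F i * G (n ∸ i)))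
      ≈⟨ Σ<-cong-< (suc n) (λ { (s≤s i≤n) → nat-split i≤n _ _ }) ⟩
    Σ< (suc n) (λ i → nat i * F i * G (n ∸ i) + F i * (nat (n ∸ i) * G (n ∸ i)))
      ≈⟨ Σ<-distrib-+ (suc n) _ _ ⟩
    (θ F ⊛ G) n + (F ⊛ θ G) n ∎

  θ-⊛-suc : ∀ F G n → (θ F ⊛ G) (suc n) ≈ (∂ F ⊛ G) n
  θ-⊛-suc F G n = begin
    (θ F ⊛ G) (suc n)                   ≈⟨ Σ<-head (suc n) _ ⟩
    0# * F 0 * G (suc n) + (∂ F ⊛ G) n  ≈⟨ +-cong (trans (*-cong (zeroˡ _) refl) (zeroˡ _)) refl ⟩
    0# + (∂ F ⊛ G) n                    ≈⟨ +-identityˡ _ ⟩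
    (∂ F ⊛ G) n                         ∎

  ∂-Leibniz : ∀ F G → ∂ (F ⊛ G) ≋ ((∂ F ⊛ G) ⊕ (F ⊛ ∂ G))
  ∂-Leibniz F G n = begin
    θ (F ⊛ G) (suc n)
      ≈⟨ θ-Leibniz F G (suc n) ⟩
    (θ F ⊛ G) (suc n) + (F ⊛ θ G) (suc n)
      ≈⟨ +-cong (θ-⊛-suc F G n) (⊛-comm F (θ G) (suc n)) ⟩
    (∂ F ⊛ G) n + (θ G ⊛ F) (suc n)
      ≈⟨ +-cong refl (trans (θ-⊛-suc G F n) (⊛-comm (∂ G) F n)) ⟩
    (∂ F ⊛ G) n + (F ⊛ ∂ G) n ∎

  powS-vanishes-below : ∀ {G} → G 0 ≈ 0# → ∀ k {n} → n < k → powS G k n ≈ 0#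
  powS-vanishes-below {G} G₀≈0 (suc k) {n} (s≤s n≤k) = Σ<-zero (suc n) term≈0
    where
    term≈0 : ∀ {i} → i < suc n → G i * powS G k (n ∸ i) ≈ 0#
    term≈0 {zero}  _         = trans (*-cong G₀≈0 refl) (zeroˡ _)
    term≈0 {suc i} (s≤s i<n) =
      trans (*-cong refl (powS-vanishes-below G₀≈0 k n∸1+i<k)) (zeroʳ _)
      where
      n∸1+i<k : n ∸ suc i < k
      n∸1+i<k = ℕ.<-≤-trans (ℕ.∸-monoʳ-< (s≤s z≤n) i<n) n≤k

  ∂-powS : ∀ G k → ∂ (powS G (suc k)) ≋ (nat (suc k) · (powS G k ⊛ ∂ G))
  ∂-powS G zero n = begin
    ∂ (G ⊛ oneS) n
      ≈⟨ ∂-cong (λ m → trans (⊛-comm G oneS m) (⊛-identityˡ G m)) n ⟩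
    ∂ G n
      ≈⟨ ⊛-identityˡ (∂ G) n ⟨
    (oneS ⊛ ∂ G) n
      ≈⟨ trans (nat-suc-* 0 _) (trans (+-cong refl (zeroˡ _)) (+-identityʳ _)) ⟨
    nat 1 * (oneS ⊛ ∂ G) n ∎
  ∂-powS G (suc k) n = begin
    ∂ (G ⊛ Gᵏ⁺¹) n
      ≈⟨ ∂-Leibniz G Gᵏ⁺¹ n ⟩
    (∂ G ⊛ Gᵏ⁺¹) n + (G ⊛ ∂ Gᵏ⁺¹) n
      ≈⟨ +-cong (⊛-comm (∂ G) Gᵏ⁺¹ n) (⊛-congʳ G (∂-powS G k) n) ⟩
    (Gᵏ⁺¹ ⊛ ∂ G) n + (G ⊛ (nat (suc k) · (powS G k ⊛ ∂ G))) n
      ≈⟨ +-cong refl (trans (⊛-· (nat (suc k)) G (powS G k ⊛ ∂ G) n)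
                            (*-cong refl (sym (⊛-assoc G (powS G k) (∂ G) n)))) ⟩
    (Gᵏ⁺¹ ⊛ ∂ G) n + nat (suc k) * (Gᵏ⁺¹ ⊛ ∂ G) n
      ≈⟨ nat-suc-* (suc k) _ ⟨
    nat (suc (suc k)) * (Gᵏ⁺¹ ⊛ ∂ G) n ∎
    where
    Gᵏ⁺¹ : Series
    Gᵏ⁺¹ = powS G (suc k)

  ∘S-cong : ∀ {A A′} G → A ≋ A′ → (A ∘S G) ≋ (A′ ∘S G)
  ∘S-cong G A≋A′ n = Σ<-cong (suc n) (λ k → *-cong (A≋A′ k) refl)

  ∘S-coeff-0 : ∀ A G → (A ∘S G) 0 ≈ A 0
  ∘S-coeff-0 A G = trans (+-identityˡ _) (*-identityʳ _)

  ∘S-coeff-extend : ∀ A {G} → G 0 ≈ 0# → ∀ {i n} → i ≤ n →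
                    (A ∘S G) i ≈ Σ< (suc n) (λ k → A k * powS G k i)
  ∘S-coeff-extend A G₀≈0 i≤n = sym (Σ<-extend _ (s≤s i≤n)
    (λ i<k → trans (*-cong refl (powS-vanishes-below G₀≈0 _ i<k)) (zeroʳ _)))

  ∂-∘S : ∀ A G → G 0 ≈ 0# → ∂ (A ∘S G) ≋ ((∂ A ∘S G) ⊛ ∂ G)
  ∂-∘S A G G₀≈0 n = begin
    nat (suc n) * Σ< (suc (suc n)) (λ k → A k * powS G k (suc n))
      ≈⟨ trans (*-distribˡ-Σ< (suc (suc n)) _ _)
               (Σ<-cong (suc (suc n)) (λ _ → x∙yz≈y∙xz _ _ _)) ⟩
    Σ< (suc (suc n)) (λ k → A k * ∂ (powS G k) n)
      ≈⟨ Σ<-head (suc n) _ ⟩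
    A 0 * ∂ oneS n + Σ< (suc n) (λ k → A (suc k) * ∂ (powS G (suc k)) n)
      ≈⟨ +-cong (trans (*-cong refl (zeroʳ _)) (zeroʳ _)) (Σ<-cong (suc n) chain) ⟩
    0# + Σ< (suc n) (λ k → ∂ A k * (powS G k ⊛ ∂ G) n)
      ≈⟨ trans (+-identityˡ _) (Σ<-cong (suc n) (λ k → *-distribˡ-Σ< (suc n) (∂ A k) _)) ⟩
    Σ< (suc n) (λ k → Σ< (suc n) (λ i → ∂ A k * (powS G k i * ∂ G (n ∸ i))))
      ≈⟨ Σ<-swap (suc n) (suc n) _ ⟩
    Σ< (suc n) (λ i → Σ< (suc n) (λ k → ∂ A k * (powS G k i * ∂ G (n ∸ i))))
      ≈⟨ Σ<-cong (suc n) (λ i → trans (Σ<-cong (suc n) (λ _ → sym (*-assoc _ _ _)))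
                                       (sym (*-distribʳ-Σ< (suc n) _ _))) ⟩
    Σ< (suc n) (λ i → Σ< (suc n) (λ k → ∂ A k * powS G k i) * ∂ G (n ∸ i))
      ≈⟨ Σ<-cong-< (suc n)
           (λ { (s≤s i≤n) → *-cong (∘S-coeff-extend (∂ A) G₀≈0 i≤n) refl }) ⟨
    ((∂ A ∘S G) ⊛ ∂ G) n ∎
    where
    chain : ∀ k → A (suc k) * ∂ (powS G (suc k)) n ≈ ∂ A k * (powS G k ⊛ ∂ G) n
    chain k =
      trans (*-cong refl (∂-powS G k n)) (trans (x∙yz≈y∙xz _ _ _) (sym (*-assoc _ _ _)))

  ColumnRecurrence : (ℕ → Series) → Set ℓ
  ColumnRecurrence P = ∀ r → ∂ (P r) ≋ (P (suc r) ⊕ (nat r · P r))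

  module _ (inv : ℕ → Carrier) (inv-! : ∀ n → nat (n !) * inv n ≈ 1#) where
    open WithFactorialInverses inv

    inv-zero : inv 0 ≈ 1#
    inv-zero = trans (sym (trans (*-cong (+-identityʳ 1#) refl) (*-identityˡ _))) (inv-! 0)

    inv-suc : ∀ n → nat (suc n) * inv (suc n) ≈ inv n
    inv-suc n = begin
      nat (suc n) * inv (suc n)                        ≈⟨ *-identityʳ _ ⟨
      nat (suc n) * inv (suc n) * 1#                   ≈⟨ *-cong refl (inv-! n) ⟨
      nat (suc n) * inv (suc n) * (nat (n !) * inv n)  ≈⟨ *-interchange _ _ _ _ ⟩
      nat (suc n) * nat (n !) * (inv (suc n) * inv n)  ≈⟨ *-cong (nat-homo-* (suc n) (n !)) refl ⟨
      nat (suc n !) * (inv (suc n) * inv n)            ≈⟨ *-assoc _ _ _ ⟨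
      nat (suc n !) * inv (suc n) * inv n              ≈⟨ *-cong (inv-! (suc n)) refl ⟩
      1# * inv n                                       ≈⟨ *-identityˡ _ ⟩
      inv n                                            ∎

    nat-suc-cancel : ∀ n {x y} → nat (suc n) * x ≈ nat (suc n) * y → x ≈ y
    nat-suc-cancel n = *-cancelˡ-invertible (begin
      nat (n !) * inv (suc n) * nat (suc n)   ≈⟨ xy∙z≈zx∙y _ _ _ ⟩
      nat (suc n) * nat (n !) * inv (suc n)   ≈⟨ *-cong (nat-homo-* (suc n) (n !)) refl ⟨
      nat (suc n !) * inv (suc n)             ≈⟨ inv-! (suc n) ⟩
      1#                                      ∎)

    ∂-induction : ∀ {I : Set} (P Q : I → Series) →
                  (∀ i → P i 0 ≈ Q i 0) →
                  (∀ n → (∀ i → P i n ≈ Q i n) → ∀ i → ∂ (P i) n ≈ ∂ (Q i) n) →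
                  ∀ i → P i ≋ Q i
    ∂-induction P Q P₀≈Q₀ ∂-step i zero    = P₀≈Q₀ i
    ∂-induction P Q P₀≈Q₀ ∂-step i (suc n) =
      nat-suc-cancel n (∂-step n (λ j → ∂-induction P Q P₀≈Q₀ ∂-step j n) i)

    ColumnRecurrence-unique : ∀ {P Q} → ColumnRecurrence P → ColumnRecurrence Q →
                              (∀ r → P r 0 ≈ Q r 0) → ∀ r → P r ≋ Q r
    ColumnRecurrence-unique {P} {Q} ∂P ∂Q P₀≈Q₀ = ∂-induction P Q P₀≈Q₀ ∂-step
      where
      ∂-step : ∀ n → (∀ r → P r n ≈ Q r n) → ∀ r → ∂ (P r) n ≈ ∂ (Q r) n
      ∂-step n P≈Q r = begin
        ∂ (P r) n                      ≈⟨ ∂P r n ⟩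
        P (suc r) n + nat r * P r n    ≈⟨ +-cong (P≈Q (suc r)) (*-cong refl (P≈Q r)) ⟩
        Q (suc r) n + nat r * Q r n    ≈⟨ ∂Q r n ⟨
        ∂ (Q r) n                      ∎

    expS-coeff-0 : ∀ x → expS x 0 ≈ 1#
    expS-coeff-0 x = trans (*-identityˡ _) inv-zero

    ∂-expS : ∀ x → ∂ (expS x) ≋ (x · expS x)
    ∂-expS x n = begin
      nat (suc n) * (x * pow x n * inv (suc n))   ≈⟨ x∙yz≈y∙xz _ _ _ ⟩
      x * pow x n * (nat (suc n) * inv (suc n))   ≈⟨ *-cong refl (inv-suc n) ⟩
      x * pow x n * inv n                         ≈⟨ *-assoc _ _ _ ⟩
      x * (pow x n * inv n)                       ∎

    ∂-expm1S : ∂ expm1S ≋ expS 1#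
    ∂-expm1S n = trans (inv-suc n) (sym (trans (*-cong (pow-1# n) refl) (*-identityˡ _)))

    -- Both sides solve P′ = (x + y) P with P(0) = 1.
    expS-+ : ∀ x y → (expS x ⊛ expS y) ≋ expS (x + y)
    expS-+ x y = ∂-induction {I = ⊤} (λ _ → expS x ⊛ expS y) (λ _ → expS (x + y))
                   (λ _ → constant) ∂-step tt
      where
      constant : (expS x ⊛ expS y) 0 ≈ expS (x + y) 0
      constant = begin
        (expS x ⊛ expS y) 0     ≈⟨ ⊛-coeff-0 (expS x) (expS y) ⟩
        expS x 0 * expS y 0     ≈⟨ *-cong (expS-coeff-0 x) (expS-coeff-0 y) ⟩
        1# * 1#                 ≈⟨ *-identityˡ 1# ⟩
        1#                      ≈⟨ expS-coeff-0 (x + y) ⟨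
        expS (x + y) 0          ∎
      ∂-step : ∀ n → (⊤ → (expS x ⊛ expS y) n ≈ expS (x + y) n) →
               ⊤ → ∂ (expS x ⊛ expS y) n ≈ ∂ (expS (x + y)) n
      ∂-step n P≈Q _ = begin
        ∂ (expS x ⊛ expS y) n
          ≈⟨ ∂-Leibniz (expS x) (expS y) n ⟩
        (∂ (expS x) ⊛ expS y) n + (expS x ⊛ ∂ (expS y)) n
          ≈⟨ +-cong (trans (⊛-congˡ (expS y) (∂-expS x) n) (·-⊛ x (expS x) (expS y) n))
                    (trans (⊛-congʳ (expS x) (∂-expS y) n) (⊛-· y (expS x) (expS y) n)) ⟩
        x * (expS x ⊛ expS y) n + y * (expS x ⊛ expS y) n
          ≈⟨ distribʳ _ x y ⟨
        (x + y) * (expS x ⊛ expS y) n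
          ≈⟨ *-cong refl (P≈Q tt) ⟩
        (x + y) * expS (x + y) n
          ≈⟨ ∂-expS (x + y) n ⟨
        ∂ (expS (x + y)) n ∎

    module _ (a : ℕ → ℕ → Carrier) where

      A : ℕ → Series
      A r k = a 0 (k +ℕ r) * inv k

      B : ℕ → Series
      B r n = a n r * inv n

      H : ℕ → Series
      H r = A r ∘S expm1S

      F : ℕ → Series
      F r = expS (nat r) ⊛ H r

      B-recurrence : (∀ n m → a (suc n) m ≈ a n (suc m) + nat m * a n m) →
                     ColumnRecurrence B
      B-recurrence a-rec r n = begin
        nat (suc n) * (a (suc n) r * inv (suc n))     ≈⟨ x∙yz≈y∙xz _ _ _ ⟩
        a (suc n) r * (nat (suc n) * inv (suc n))     ≈⟨ *-cong (a-rec n r) (inv-suc n) ⟩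
        (a n (suc r) + nat r * a n r) * inv n         ≈⟨ distribʳ _ _ _ ⟩
        a n (suc r) * inv n + nat r * a n r * inv n   ≈⟨ +-cong refl (*-assoc _ _ _) ⟩
        B (suc r) n + nat r * B r n                   ∎

      ∂-A : ∀ r → ∂ (A r) ≋ A (suc r)
      ∂-A r n = begin
        nat (suc n) * (a 0 (suc n +ℕ r) * inv (suc n))
          ≈⟨ x∙yz≈y∙xz _ _ _ ⟩
        a 0 (suc n +ℕ r) * (nat (suc n) * inv (suc n))
          ≈⟨ *-cong (reflexive (≡.cong (a 0) (≡.sym (ℕ.+-suc n r)))) (inv-suc n) ⟩
        a 0 (n +ℕ suc r) * inv n ∎

      ∂-H : ∀ r → ∂ (H r) ≋ (H (suc r) ⊛ expS 1#)
      ∂-H r n = begin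
        ∂ (A r ∘S expm1S) n
          ≈⟨ ∂-∘S (A r) expm1S refl n ⟩
        ((∂ (A r) ∘S expm1S) ⊛ ∂ expm1S) n
          ≈⟨ ⊛-congˡ (∂ expm1S) (∘S-cong expm1S (∂-A r)) n ⟩
        (H (suc r) ⊛ ∂ expm1S) n
          ≈⟨ ⊛-congʳ (H (suc r)) ∂-expm1S n ⟩
        (H (suc r) ⊛ expS 1#) n ∎

      F-recurrence : ColumnRecurrence F
      F-recurrence r n = begin
        ∂ (Eʳ ⊛ H r) n
          ≈⟨ ∂-Leibniz Eʳ (H r) n ⟩
        (∂ Eʳ ⊛ H r) n + (Eʳ ⊛ ∂ (H r)) n
          ≈⟨ +-cong (trans (⊛-congˡ (H r) (∂-expS (nat r)) n) (·-⊛ (nat r) Eʳ (H r) n))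
                    (⊛-congʳ Eʳ (∂-H r) n) ⟩
        nat r * F r n + (Eʳ ⊛ (H (suc r) ⊛ expS 1#)) n
          ≈⟨ +-comm _ _ ⟩
        (Eʳ ⊛ (H (suc r) ⊛ expS 1#)) n + nat r * F r n
          ≈⟨ +-cong merge-exponentials refl ⟩
        F (suc r) n + nat r * F r n ∎
        where
        Eʳ : Series
        Eʳ = expS (nat r)
        merge-exponentials : (Eʳ ⊛ (H (suc r) ⊛ expS 1#)) n ≈ F (suc r) n
        merge-exponentials = begin
          (Eʳ ⊛ (H (suc r) ⊛ expS 1#)) n   ≈⟨ ⊛-congʳ Eʳ (⊛-comm (H (suc r)) (expS 1#)) n ⟩
          (Eʳ ⊛ (expS 1# ⊛ H (suc r))) n   ≈⟨ ⊛-assoc Eʳ (expS 1#) (H (suc r)) n ⟨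
          ((Eʳ ⊛ expS 1#) ⊛ H (suc r)) n   ≈⟨ ⊛-congˡ (H (suc r)) (⊛-comm Eʳ (expS 1#)) n ⟩
          ((expS 1# ⊛ Eʳ) ⊛ H (suc r)) n   ≈⟨ ⊛-congˡ (H (suc r)) (expS-+ 1# (nat r)) n ⟩
          F (suc r) n                      ∎

      B₀≈F₀ : ∀ r → B r 0 ≈ F r 0
      B₀≈F₀ r = sym (begin
        (expS (nat r) ⊛ H r) 0
          ≈⟨ ⊛-coeff-0 (expS (nat r)) (H r) ⟩
        expS (nat r) 0 * H r 0
          ≈⟨ *-cong (expS-coeff-0 (nat r)) (∘S-coeff-0 (A r) expm1S) ⟩
        1# * A r 0
          ≈⟨ *-identityˡ _ ⟩
        B r 0 ∎)

theorem3 : {c ℓ : Level} (R : CommutativeRing c ℓ) →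
           let open CommutativeRing R in
           let open PowerSeries R in
           (inv : ℕ → Carrier) → (∀ n → nat (n !) * inv n ≈ 1#) →
           let open WithFactorialInverses inv in
           (a : ℕ → ℕ → Carrier) →
           (∀ n m → a (suc n) m ≈ a n (suc m) + nat m * a n m) →
           (r : ℕ) →
           (λ n → a n r * inv n) ≋ (expS (nat r) ⊛ ((λ k → a 0 (k +ℕ r) * inv k) ∘S expm1S))
theorem3 R inv inv-! a a-rec =
  ColumnRecurrence-unique R inv inv-!
    (B-recurrence R inv inv-! a a-rec)
    (F-recurrence R inv inv-! a)
    (B₀≈F₀ R inv inv-! a)
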